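{- Consider a run of GFtP on a WMST-instance $(G,\hat w,w)$ with any arrival order, and suppose GFtP has just rejected an edge $e'$ (so $e'\notin T$ for the current tree $T$). Then at any later moment of the run, with $T$ the current tree and $U$ the current set of unseen edges, every edge $e\in U$ lying on the unique cycle of $T\cup\{e'\}$ satisfies $\hat w(e)<w(e')$.
   Context: A WMST-instance is a triple $(G,\hat w,w)$ with $G=(V,E)$ a finite simple connected undirected graph and $\hat w,w\colon E\to\mathbb{R}^+$ predicted and true edge weights. The algorithm knows $G$ and $\hat w$ in advance; the true weights arrive one by one as pairs $(w(e),e)$, each edge once. Algorithm GFtP: initially let $T$ be a minimum spanning tree of $G$ w.r.t. $\hat w$ and $U=E$ (the unseen edges). Upon arrival of $(w(e_i),e_i)$: set $U:=U\setminus\{e_i\}$. If $e_i\in T$, accept $e_i$. Otherwise let $C$ be the cycle $e_i$ creates in $T\cup\{e_i\}$ and $C'=U\cap C$; if $C'\ne\emptyset$, let $e_{\max}$ be an edge of $C'$ of maximum $\hat w$; if $w(e_i)\le\hat w(e_{\max})$, set $T:=(T\setminus\{e_{\max}\})\cup\{e_i\}$ and accept $e_i$. Otherwise reject $e_i$.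
   Formalization: The predicted and true edge weights $\hat w$ and $w$ take positive rational values rather than values in $\mathbb{R}^+$. -}

module Defs where

open import Data.Nat using (ℕ; zero; suc; _≤_; _<_)
open import Data.Fin using (Fin; toℕ)
open import Data.Fin.Subset using (Subset; _∈_; _∉_; inside; outside)
open import Data.Vec using (lookup; _[_]≔_)
open import Data.List using (List; []; _∷_; map; foldr; allFin)
open import Data.List.Membership.Propositional using () renaming (_∈_ to _∈ˡ_)
open import Data.List.Relation.Unary.Unique.Propositional using (Unique)
open import Data.Product using (Σ; _×_; _,_; proj₁; proj₂; ∃; ∃-syntax)
open import Data.Sum using (_⊎_)
open import Data.Bool using (Bool; true; false; if_then_else_)
open import Data.Rational using (ℚ; 0ℚ; _+_) renaming (_≤_ to _≤ℚ_; _<_ to _<ℚ_)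
open import Relation.Binary.PropositionalEquality using (_≡_; _≢_)
open import Relation.Nullary using (¬_)
open import Function.Definitions using (Bijective)

record Graph : Set where
  field
    n    : ℕ
    m    : ℕ
    ends : Fin m → Fin n × Fin n
    loopless : ∀ e → proj₁ (ends e) ≢ proj₂ (ends e)
    noParallel : ∀ e f →
      ((ends e ≡ ends f) ⊎ (ends e ≡ (proj₂ (ends f) , proj₁ (ends f)))) → e ≡ f

module _ (G : Graph) where
  open Graph G

  V : Set
  V = Fin n

  E : Set
  E = Fin m

  EdgeSet : Set
  EdgeSet = Subset m

  Joins : E → V → V → Set
  Joins e u v = (ends e ≡ (u , v)) ⊎ (ends e ≡ (v , u))

  data Walk (S : EdgeSet) : V → V → Set where
    []   : ∀ {u} → Walk S u u
    step : ∀ {u x v} (e : E) → e ∈ S → Joins e u x → Walk S x v → Walk S u v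

  edgesOf : ∀ {S u v} → Walk S u v → List E
  edgesOf []              = []
  edgesOf (step e _ _ p)  = e ∷ edgesOf p

  vertsOf : ∀ {S u v} → Walk S u v → List V
  vertsOf {u = u} []             = u ∷ []
  vertsOf {u = u} (step e _ _ p) = u ∷ vertsOf p

  IsPath : ∀ {S u v} → Walk S u v → Set
  IsPath p = Unique (vertsOf p)

  allEdges : EdgeSet
  allEdges = Data.Vec.replicate m inside
    where import Data.Vec

  Connected : EdgeSet → Set
  Connected S = ∀ (u v : V) → Walk S u v

  -- S contains a cycle: an edge e ∈ S, with endpoints (u , v), together with
  -- a path in S from v back to u not using e (this closed trail has ≥ 3
  -- distinct vertices since G is simple).
  HasCycle : EdgeSet → Set
  HasCycle S = Σ E λ e → e ∈ S × Σ (Walk S (proj₂ (ends e)) (proj₁ (ends e))) λ p →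
                 IsPath p × ¬ (e ∈ˡ edgesOf p)

  Acyclic : EdgeSet → Set
  Acyclic S = ¬ HasCycle S

  IsSpanningTree : EdgeSet → Set
  IsSpanningTree T = Connected T × Acyclic T

  weight : (E → ℚ) → EdgeSet → ℚ
  weight c S = foldr _+_ 0ℚ (map (λ e → if lookup S e then c e else 0ℚ) (allFin m))

  IsMST : (E → ℚ) → EdgeSet → Set
  IsMST c T = IsSpanningTree T × (∀ T' → IsSpanningTree T' → weight c T ≤ℚ weight c T')

  -- f lies on the cycle that e creates in T ∪ {e}: either f = e, or f lies on
  -- the (unique, T being a tree) path in T between the endpoints of e.
  OnCycle : EdgeSet → E → E → Set
  OnCycle T e f = (f ≡ e) ⊎
    (Σ (Walk T (proj₁ (ends e)) (proj₂ (ends e))) λ p → IsPath p × (f ∈ˡ edgesOf p))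

  swapEdge : EdgeSet → E → E → EdgeSet
  swapEdge T d a = (T [ d ]≔ outside) [ a ]≔ inside

  -- T: current tree; U: unseen edges AFTER removing e
  -- (the arriving edge); the step yields the new tree and whether e was
  -- accepted (true) or rejected (false).  The choice of e_max among maxima
  -- is nondeterministic.
  module _ (ŵ w : E → ℚ) where
    data Step (T : EdgeSet) (U : E → Set) (e : E) : EdgeSet → Bool → Set where
      acceptInT : e ∈ T → Step T U e T true
      acceptSwap : e ∉ T → (emax : E) → U emax → OnCycle T e emax →
                   (∀ f → U f → OnCycle T e f → ŵ f ≤ℚ ŵ emax) →
                   w e ≤ℚ ŵ emax → Step T U e (swapEdge T emax e) true
      rejectEmpty : e ∉ T → (∀ f → U f → ¬ OnCycle T e f) → Step T U e T false
      rejectHeavy : e ∉ T → (emax : E) → U emax → OnCycle T e emax →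
                    (∀ f → U f → OnCycle T e f → ŵ f ≤ℚ ŵ emax) →
                    ¬ (w e ≤ℚ ŵ emax) → Step T U e T false

  -- edges not yet seen after the first k arrivals (arr i = edge arriving at
  -- position i, 0-based)
  Unseen : (E → E) → ℕ → E → Set
  Unseen arr k f = ∀ (j : Fin m) → toℕ j < k → arr j ≢ f

  -- A run of GFtP on the WMST-instance (G, ŵ, w) with arrival order arr.
  -- tree k = the current tree after k arrivals (0 ≤ k ≤ m);
  -- acc i  = whether the i-th arriving edge was accepted.
  record Run (ŵ w : E → ℚ) : Set where
    field
      arr     : E → E
      arrBij  : Bijective _≡_ _≡_ arr
      tree    : ℕ → EdgeSet
      acc     : E → Bool
      initMST : IsMST ŵ (tree 0)
      steps   : ∀ (i : Fin m) →
                Step ŵ w (tree (toℕ i)) (Unseen arr (suc (toℕ i))) (arr i)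
                     (tree (suc (toℕ i))) (acc i)

Positive : ∀ {A : Set} → (A → ℚ) → Set
Positive {A} c = ∀ (a : A) → 0ℚ <ℚ c a

{-# OPTIONS --safe #-}
-- In a spanning tree T, an edge f lies on the cycle closed by e′ exactly when f ∈ T
-- and T − f no longer joins the endpoints of e′.  So it suffices to keep, from the
-- rejection of e′ on, the invariant that every unseen such separator f has
-- ŵ f < w e′.  At the rejection the separators are the unseen cycle edges, which
-- are either absent or bounded by ŵ e_max < w e′.  Accepting an edge a and
-- dropping d can only make f a new separator if T − f joined the ends of e′
-- through d; then f separates the ends of a in T, so ŵ f ≤ ŵ d by the choice of d,
-- and d separated the ends of e′, so ŵ d < w e′ by the invariant.
module Submission where

open import Defs
open import Data.Nat using (ℕ; suc; _≤_)
open import Data.Fin using (Fin; toℕ)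
open import Data.Bool using (false)
open import Data.Rational using (ℚ) renaming (_<_ to _<ℚ_)
open import Relation.Binary.PropositionalEquality using (_≡_)

open import Level using (0ℓ)
open import Data.Nat using (zero; _<_; _≤′_; ≤′-refl; ≤′-step; s≤s)
open import Data.Nat.Properties using (≤-reflexive; <⇒≤; m<n⇒m<1+n; ≤⇒≤′)
open import Data.Fin using (fromℕ<; _≟_)
open import Data.Fin.Properties using (toℕ<n; toℕ-fromℕ<)
open import Data.Fin.Subset using (outside; inside) renaming (_∈_ to _∈ₛ_)
open import Data.Vec using (lookup; _[_]≔_)
open import Data.Vec.Properties
  using ([]≔-updates; []≔-minimal; []=⇒lookup; lookup⇒[]=; lookup∘update; lookup∘update′)
open import Data.List.Membership.Propositional using () renaming (_∈_ to _∈ˡ_)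
open import Data.List.Relation.Unary.Any using (here; there)
open import Data.List.Relation.Unary.All using (All; []; _∷_) renaming (lookup to All-lookup)
open import Data.List.Relation.Unary.All.Properties using (¬Any⇒All¬)
open import Data.List.Relation.Unary.AllPairs using ([]; _∷_)
open import Data.Product using (Σ; _×_; _,_; proj₁; proj₂)
open import Data.Sum using (_⊎_; inj₁; inj₂)
open import Function using (_∘_; id)
open import Relation.Nullary using (¬_; yes; no; contradiction)
open import Relation.Nullary.Decidable using (decidable-stable)
open import Relation.Unary using (Pred; _⊆_; _∪_; _∖_; ｛_｝)
open import Relation.Binary using (Rel)
open import Relation.Binary.Construct.Closure.ReflexiveTransitive
  using (Star; ε; _◅_; _◅◅_; reverse) renaming (map to Star-map)
open import Relation.Binary.PropositionalEquality using (refl; sym; trans; subst; cong; _≢_; ≢-sym)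
open import Data.Rational.Properties using (_<?_; ≤-<-trans; ≰⇒>)

module Connectivity (G : Graph) where
  open Graph G
  open import Data.List.Membership.DecPropositional (_≟_ {n}) using () renaming (_∈?_ to _∈ᵥ?_)
  open import Data.List.Membership.DecPropositional (_≟_ {m}) using () renaming (_∈?_ to _∈ₑ?_)

  EdgePred : Set₁
  EdgePred = Pred (E G) 0ℓ

  ⟦_⟧ : EdgeSet G → EdgePred
  ⟦ S ⟧ h = h ∈ₛ S

  infixl 7 _─_
  _─_ : EdgePred → E G → EdgePred
  P ─ f = P ∖ ｛ f ｝

  Adjacent : EdgePred → Rel (V G) 0ℓ
  Adjacent P u x = Σ (E G) λ e → P e × Joins G e u x

  Linked : EdgePred → Rel (V G) 0ℓ
  Linked P = Star (Adjacent P)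

  Joined : EdgePred → V G × V G → Set
  Joined P (u , v) = Linked P u v

  Matched : EdgePred → V G × V G → V G × V G → Set
  Matched P (u , v) (x , y) = (Linked P u x × Linked P v y) ⊎ (Linked P u y × Linked P v x)

  joins-sym : ∀ {e u x} → Joins G e u x → Joins G e x u
  joins-sym (inj₁ eq) = inj₂ eq
  joins-sym (inj₂ eq) = inj₁ eq

  linked-sym : ∀ {P u v} → Linked P u v → Linked P v u
  linked-sym = reverse λ (e , e∈P , j) → e , e∈P , joins-sym j

  linked-mono : ∀ {P Q u v} → P ⊆ Q → Linked P u v → Linked Q u v
  linked-mono P⊆Q = Star-map λ (e , e∈P , j) → e , P⊆Q e∈P , j

  edge-joined : ∀ {P e} → P e → Joined P (ends e)
  edge-joined e∈P = (_ , e∈P , inj₁ refl) ◅ ε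

  matched-sym : ∀ {P p q} → Matched P p q → Matched P q p
  matched-sym (inj₁ (ux , vy)) = inj₁ (linked-sym ux , linked-sym vy)
  matched-sym (inj₂ (uy , vx)) = inj₂ (linked-sym vx , linked-sym uy)

  matched-trans : ∀ {P p q r} → Matched P p q → Matched P q r → Matched P p r
  matched-trans (inj₁ (ux , vy)) (inj₁ (xa , yb)) = inj₁ (ux ◅◅ xa , vy ◅◅ yb)
  matched-trans (inj₁ (ux , vy)) (inj₂ (xb , ya)) = inj₂ (ux ◅◅ xb , vy ◅◅ ya)
  matched-trans (inj₂ (uy , vx)) (inj₁ (xa , yb)) = inj₂ (uy ◅◅ yb , vx ◅◅ xa)
  matched-trans (inj₂ (uy , vx)) (inj₂ (xb , ya)) = inj₁ (uy ◅◅ ya , vx ◅◅ xb)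

  matched-mono : ∀ {P Q p q} → P ⊆ Q → Matched P p q → Matched Q p q
  matched-mono P⊆Q (inj₁ (ux , vy)) = inj₁ (linked-mono P⊆Q ux , linked-mono P⊆Q vy)
  matched-mono P⊆Q (inj₂ (uy , vx)) = inj₂ (linked-mono P⊆Q uy , linked-mono P⊆Q vx)

  matched-transport : ∀ {P p q} → Joined P p → Matched P p q → Joined P q
  matched-transport uv (inj₁ (ux , vy)) = linked-sym ux ◅◅ uv ◅◅ vy
  matched-transport uv (inj₂ (uy , vx)) = linked-sym vx ◅◅ linked-sym uv ◅◅ uy

  matched-prepend : ∀ {P u x v q} → Linked P u x → Matched P (x , v) q → Matched P (u , v) q
  matched-prepend ux (inj₁ (xa , vb)) = inj₁ (ux ◅◅ xa , vb)
  matched-prepend ux (inj₂ (xb , va)) = inj₂ (ux ◅◅ xb , va)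

  joined-through-edge : ∀ {P y r q} → P y → Matched P r q → Matched P (ends y) q → Joined P r
  joined-through-edge y∈P r~q y~q = matched-transport (edge-joined y∈P) (matched-trans y~q (matched-sym r~q))

  split-off : ∀ {P} f → P ⊆ (P ─ f) ∪ ｛ f ｝
  split-off f {h} h∈P with f ≟ h
  ... | yes f≡h = inj₂ f≡h
  ... | no f≢h = inj₁ (h∈P , f≢h)

  joins-matched : ∀ {P e u x v} → Joins G e u x → Linked P x v → Matched P (u , v) (ends e)
  joins-matched (inj₁ eq) xv rewrite eq = inj₁ (ε , linked-sym xv)
  joins-matched (inj₂ eq) xv rewrite eq = inj₂ (ε , linked-sym xv)

  joins-rematched : ∀ {P e u x v} → Joins G e u x → Matched P (x , v) (ends e) →
                    Linked P u v ⊎ Matched P (u , v) (ends e)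
  joins-rematched (inj₁ eq) M rewrite eq with M
  ... | inj₁ (_ , vx) = inj₂ (inj₁ (ε , vx))
  ... | inj₂ (_ , vu) = inj₁ (linked-sym vu)
  joins-rematched (inj₂ eq) M rewrite eq with M
  ... | inj₁ (_ , vu) = inj₁ (linked-sym vu)
  ... | inj₂ (_ , vx) = inj₂ (inj₂ (ε , vx))

  split-at-edge : ∀ {P e u v} → Linked (P ∪ ｛ e ｝) u v → Linked P u v ⊎ Matched P (u , v) (ends e)
  split-at-edge ε = inj₁ ε
  split-at-edge ((g , inj₁ g∈P , j) ◅ rest) with split-at-edge rest
  ... | inj₁ xv = inj₁ ((g , g∈P , j) ◅ xv)
  ... | inj₂ M  = inj₂ (matched-prepend ((g , g∈P , j) ◅ ε) M)
  split-at-edge ((_ , inj₂ refl , j) ◅ rest) with split-at-edge rest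
  ... | inj₁ xv = inj₂ (joins-matched j xv)
  ... | inj₂ M  = joins-rematched j M

  avoids-or-crosses : ∀ {P u v} e → Linked P u v → Linked (P ─ e) u v ⊎ Matched (P ─ e) (u , v) (ends e)
  avoids-or-crosses {P} e = split-at-edge {P ─ e} ∘ linked-mono (split-off {P} e)

  separated⇒matched : ∀ {P y q} → Joined P q → ¬ Joined (P ─ y) q → Matched (P ─ y) q (ends y)
  separated⇒matched {y = y} q-joined cut with avoids-or-crosses y q-joined
  ... | inj₁ avoiding = contradiction avoiding cut
  ... | inj₂ M = M

  walk⇒linked : ∀ {S P u v} (p : Walk G S u v) → (∀ {h} → h ∈ˡ edgesOf G p → P h) → Linked P u v
  walk⇒linked [] _ = ε
  walk⇒linked (step e _ j p) in-P = (e , in-P (here refl) , j) ◅ walk⇒linked p (in-P ∘ there)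

  edgesOf-⊆ : ∀ {S u v h} (p : Walk G S u v) → h ∈ˡ edgesOf G p → h ∈ₛ S
  edgesOf-⊆ (step _ e∈S _ _) (here refl) = e∈S
  edgesOf-⊆ (step _ _ _ p) (there h∈p) = edgesOf-⊆ p h∈p

  head-∈-vertsOf : ∀ {S u v} (p : Walk G S u v) → u ∈ˡ vertsOf G p
  head-∈-vertsOf [] = here refl
  head-∈-vertsOf (step _ _ _ _) = here refl

  ends-∈-vertsOf : ∀ {S u v h} (p : Walk G S u v) → h ∈ˡ edgesOf G p →
                   proj₁ (ends h) ∈ˡ vertsOf G p × proj₂ (ends h) ∈ˡ vertsOf G p
  ends-∈-vertsOf (step _ _ (inj₁ eq) p) (here refl) rewrite eq = here refl , there (head-∈-vertsOf p)
  ends-∈-vertsOf (step _ _ (inj₂ eq) p) (here refl) rewrite eq = there (head-∈-vertsOf p) , here refl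
  ends-∈-vertsOf (step _ _ _ p) (there h∈p) with ends-∈-vertsOf p h∈p
  ... | x∈p , y∈p = there x∈p , there y∈p

  edge-not-revisited : ∀ {S g u x v} (p : Walk G S x v) → Joins G g u x →
                       All (u ≢_) (vertsOf G p) → ¬ g ∈ˡ edgesOf G p
  edge-not-revisited p (inj₁ eq) u∉p g∈p =
    All-lookup u∉p (proj₁ (ends-∈-vertsOf p g∈p)) (sym (cong proj₁ eq))
  edge-not-revisited p (inj₂ eq) u∉p g∈p =
    All-lookup u∉p (proj₂ (ends-∈-vertsOf p g∈p)) (sym (cong proj₂ eq))

  path-through-edge : ∀ {S u v f} (p : Walk G S u v) → IsPath G p → f ∈ˡ edgesOf G p →
                      Matched (⟦ S ⟧ ─ f) (u , v) (ends f)
  path-through-edge (step _ _ j p) (u∉p ∷ _) (here refl) =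
    joins-matched j
      (walk⇒linked p λ h∈p → edgesOf-⊆ p h∈p , λ { refl → edge-not-revisited p j u∉p h∈p })
  path-through-edge {f = f} (step g g∈S j p) (u∉p ∷ p-path) (there f∈p) =
    matched-prepend ((g , (g∈S , f≢g) , j) ◅ ε) (path-through-edge p p-path f∈p)
    where
    f≢g : f ≢ g
    f≢g refl = edge-not-revisited p j u∉p f∈p

  PathIn : EdgeSet G → EdgePred → V G → V G → Set
  PathIn S P u v = Σ (Walk G S u v) λ p → IsPath G p × All P (edgesOf G p)

  path-suffix : ∀ {S P u x v} (p : Walk G S x v) → u ∈ˡ vertsOf G p →
                IsPath G p → All P (edgesOf G p) → PathIn S P u v
  path-suffix [] (here refl) p-path in-P = [] , p-path , in-P
  path-suffix p@(step _ _ _ _) (here refl) p-path in-P = p , p-path , in-P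
  path-suffix (step _ _ _ p) (there u∈p) (_ ∷ p-path) (_ ∷ in-P) = path-suffix p u∈p p-path in-P

  loop-erase : ∀ {S P u v} → P ⊆ ⟦ S ⟧ → Linked P u v → PathIn S P u v
  loop-erase _ ε = [] , [] ∷ [] , []
  loop-erase {u = u} P⊆S ((e , e∈P , j) ◅ rest) with loop-erase P⊆S rest
  ... | p , p-path , in-P with u ∈ᵥ? vertsOf G p
  ... | yes u∈p = path-suffix p u∈p p-path in-P
  ... | no u∉p = step e (P⊆S e∈P) j p , ¬Any⇒All¬ _ u∉p ∷ p-path , e∈P ∷ in-P

  record MinimallyConnected (S : EdgeSet G) : Set where
    field
      linked : ∀ u v → Linked ⟦ S ⟧ u v
      bridge : ∀ {g} → g ∈ₛ S → ¬ Joined (⟦ S ⟧ ─ g) (ends g)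

  open MinimallyConnected public

  spanningTree⇒minimallyConnected : ∀ {S} → IsSpanningTree G S → MinimallyConnected S
  spanningTree⇒minimallyConnected (connected , _) .linked u v =
    walk⇒linked (connected u v) (edgesOf-⊆ (connected u v))
  spanningTree⇒minimallyConnected (_ , acyclic) .bridge {g} g∈S g-joined
    with loop-erase proj₁ (linked-sym g-joined)
  ... | p , p-path , avoids-g = acyclic (g , g∈S , p , p-path , λ g∈p → proj₂ (All-lookup avoids-g g∈p) refl)

  Separates : EdgeSet G → E G → V G × V G → Set
  Separates S f q = f ∈ₛ S × ¬ Joined (⟦ S ⟧ ─ f) q

  onCycle⇒separates : ∀ {S e f} → MinimallyConnected S → OnCycle G S e f → f ≢ e → Separates S f (ends e)
  onCycle⇒separates _ (inj₁ f≡e) f≢e = contradiction f≡e f≢e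
  onCycle⇒separates S-mc (inj₂ (p , p-path , f∈p)) _ =
    f∈S , λ e-joined → bridge S-mc f∈S (matched-transport e-joined (path-through-edge p p-path f∈p))
    where
    f∈S = edgesOf-⊆ p f∈p

  separates⇒onCycle : ∀ {S e f} → (∀ u v → Linked ⟦ S ⟧ u v) → Separates S f (ends e) → OnCycle G S e f
  separates⇒onCycle {e = e} {f} S-linked (_ , cut)
    with loop-erase id (S-linked (proj₁ (ends e)) (proj₂ (ends e)))
  ... | p , p-path , _ with f ∈ₑ? edgesOf G p
  ... | yes f∈p = inj₂ (p , p-path , f∈p)
  ... | no f∉p = contradiction (walk⇒linked p λ h∈p → edgesOf-⊆ p h∈p , λ { refl → f∉p h∈p }) cut

  swap-⊇ : ∀ {T d a} → (⟦ T ⟧ ─ d) ∪ ｛ a ｝ ⊆ ⟦ swapEdge G T d a ⟧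
  swap-⊇ {T} {d} {a} (inj₂ refl) = []≔-updates (T [ d ]≔ outside) a
  swap-⊇ {T} {d} {a} {h} (inj₁ (h∈T , d≢h)) with a ≟ h
  ... | yes refl = []≔-updates (T [ d ]≔ outside) a
  ... | no a≢h = []≔-minimal _ h a (≢-sym a≢h) ([]≔-minimal T h d (≢-sym d≢h) h∈T)

  swap-⊆ : ∀ {T d a} → ⟦ swapEdge G T d a ⟧ ⊆ (⟦ T ⟧ ─ d) ∪ ｛ a ｝
  swap-⊆ {T} {d} {a} {h} h∈T′ with a ≟ h
  ... | yes a≡h = inj₂ a≡h
  ... | no a≢h = inj₁ (lookup⇒[]= h T in-T , d≢h)
    where
    in-T─d : lookup (T [ d ]≔ outside) h ≡ inside
    in-T─d = trans (sym (lookup∘update′ (≢-sym a≢h) (T [ d ]≔ outside) inside)) ([]=⇒lookup h∈T′)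
    d≢h : d ≢ h
    d≢h refl = contradiction (trans (sym (lookup∘update d T outside)) in-T─d) λ ()
    in-T : lookup T h ≡ inside
    in-T = trans (sym (lookup∘update′ (≢-sym d≢h) T outside)) in-T─d

  swap-kept : ∀ {T d a h} → h ∈ₛ swapEdge G T d a → h ≢ a → h ∈ₛ T × d ≢ h
  swap-kept h∈T′ h≢a with swap-⊆ h∈T′
  ... | inj₁ kept = kept
  ... | inj₂ a≡h = contradiction (sym a≡h) h≢a

  swap-preserves-minimallyConnected : ∀ {T d a} → MinimallyConnected T → Separates T d (ends a) →
                                      MinimallyConnected (swapEdge G T d a)
  swap-preserves-minimallyConnected {T} {d} {a} T-mc (d∈T , d-cuts-a) =
    record { linked = linked′ ; bridge = bridge′ }
    where
    a~d : Matched (⟦ T ⟧ ─ d) (ends a) (ends d)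
    a~d = separated⇒matched (linked T-mc _ _) d-cuts-a

    kept : ⟦ T ⟧ ─ d ⊆ ⟦ swapEdge G T d a ⟧
    kept = swap-⊇ ∘ inj₁

    linked′ : ∀ u v → Linked ⟦ swapEdge G T d a ⟧ u v
    linked′ u v with avoids-or-crosses d (linked T-mc u v)
    ... | inj₁ avoiding = linked-mono kept avoiding
    ... | inj₂ uv~d =
      joined-through-edge (swap-⊇ (inj₂ refl)) (matched-mono kept uv~d) (matched-mono kept a~d)

    bridge′ : ∀ {g} → g ∈ₛ swapEdge G T d a → ¬ Joined (⟦ swapEdge G T d a ⟧ ─ g) (ends g)
    bridge′ {g} g∈T′ g-joined with swap-⊆ g∈T′
    ... | inj₂ refl = d-cuts-a (linked-mono (λ (h∈T′ , a≢h) → swap-kept h∈T′ (≢-sym a≢h)) g-joined)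
    ... | inj₁ (g∈T , d≢g) with split-at-edge {⟦ T ⟧ ─ d ─ g} {a} (linked-mono T′─g⊆ g-joined)
      where
      T′─g⊆ : ⟦ swapEdge G T d a ⟧ ─ g ⊆ (⟦ T ⟧ ─ d ─ g) ∪ ｛ a ｝
      T′─g⊆ (h∈T′ , g≢h) with swap-⊆ h∈T′
      ... | inj₁ h∈T─d = inj₁ (h∈T─d , g≢h)
      ... | inj₂ a≡h = inj₂ a≡h
    ... | inj₁ avoiding = bridge T-mc g∈T (linked-mono (λ ((h∈T , _) , g≢h) → h∈T , g≢h) avoiding)
    ... | inj₂ g~a = bridge T-mc d∈T
                       (joined-through-edge (g∈T , d≢g) (matched-sym a~d) (matched-mono proj₁ g~a))

  swap-separates : ∀ {T d a f q} → MinimallyConnected T → Separates T d (ends a) → f ≢ a →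
                   Separates (swapEdge G T d a) f q → Joined (⟦ T ⟧ ─ f) q →
                   Separates T f (ends a) × Separates T d q
  swap-separates {T} {d} {a} {f} {q} T-mc (d∈T , d-cuts-a) f≢a (f∈T′ , f-cuts′) q-joined =
    (f∈T , f-cuts-a) , (d∈T , d-cuts-q)
    where
    f∈T : f ∈ₛ T
    f∈T = proj₁ (swap-kept f∈T′ f≢a)
    d≢f : d ≢ f
    d≢f = proj₂ (swap-kept f∈T′ f≢a)

    into-T′─f : ∀ {h} → h ∈ₛ T → d ≢ h → f ≢ h → h ∈ₛ swapEdge G T d a × f ≢ h
    into-T′─f h∈T d≢h f≢h = swap-⊇ (inj₁ (h∈T , d≢h)) , f≢h

    q~d : Matched (⟦ T ⟧ ─ f ─ d) q (ends d)
    q~d = separated⇒matched q-joined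
            (f-cuts′ ∘ linked-mono λ ((h∈T , f≢h) , d≢h) → into-T′─f h∈T d≢h f≢h)

    f-cuts-a : ¬ Joined (⟦ T ⟧ ─ f) (ends a)
    f-cuts-a a-joined =
      f-cuts′ (joined-through-edge (swap-⊇ (inj₂ refl) , f≢a)
                 (matched-mono T─f─d⊆ q~d) (matched-mono T─f─d⊆ a~d))
      where
      T─f─d⊆ : ⟦ T ⟧ ─ f ─ d ⊆ ⟦ swapEdge G T d a ⟧ ─ f
      T─f─d⊆ ((h∈T , f≢h) , d≢h) = into-T′─f h∈T d≢h f≢h
      a~d : Matched (⟦ T ⟧ ─ f ─ d) (ends a) (ends d)
      a~d = separated⇒matched a-joined (d-cuts-a ∘ linked-mono λ ((h∈T , _) , d≢h) → h∈T , d≢h)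

    d-cuts-q : ¬ Joined (⟦ T ⟧ ─ d) q
    d-cuts-q q-joined′ =
      bridge T-mc d∈T (joined-through-edge (f∈T , d≢f)
                        (matched-sym (matched-mono T─f─d⊆T─d q~d)) (matched-sym (matched-mono proj₁ q~f)))
      where
      T─f─d⊆T─d : ⟦ T ⟧ ─ f ─ d ⊆ ⟦ T ⟧ ─ d
      T─f─d⊆T─d ((h∈T , _) , d≢h) = h∈T , d≢h
      q~f : Matched (⟦ T ⟧ ─ d ─ f) q (ends f)
      q~f = separated⇒matched q-joined′
              (f-cuts′ ∘ linked-mono λ ((h∈T , d≢h) , f≢h) → into-T′─f h∈T d≢h f≢h)

module GFtP (G : Graph) (ŵ w : E G → ℚ) where
  open Graph G
  open Connectivity G

  step-preserves-minimallyConnected : ∀ {T U a T′ b} → MinimallyConnected T → ¬ U a →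
                                      Step G ŵ w T U a T′ b → MinimallyConnected T′
  step-preserves-minimallyConnected T-mc _ (acceptInT _) = T-mc
  step-preserves-minimallyConnected T-mc a∉U (acceptSwap _ d d∈U d-on-cycle _ _) =
    swap-preserves-minimallyConnected T-mc (onCycle⇒separates T-mc d-on-cycle λ { refl → a∉U d∈U })
  step-preserves-minimallyConnected T-mc _ (rejectEmpty _ _) = T-mc
  step-preserves-minimallyConnected T-mc _ (rejectHeavy _ _ _ _ _ _) = T-mc

  SeparatorsLighter : E G → EdgeSet G → EdgePred → Set
  SeparatorsLighter e′ T U = ∀ {f} → U f → Separates T f (ends e′) → ŵ f <ℚ w e′

  rejection-establishes : ∀ {T U e′ T′ b} → (∀ u v → Linked ⟦ T ⟧ u v) →
                          Step G ŵ w T U e′ T′ b → b ≡ false → SeparatorsLighter e′ T′ U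
  rejection-establishes T-linked (rejectEmpty _ none) refl f∈U f-sep =
    contradiction (separates⇒onCycle T-linked f-sep) (none _ f∈U)
  rejection-establishes T-linked (rejectHeavy _ _ _ _ maximal heavy) refl f∈U f-sep =
    ≤-<-trans (maximal _ f∈U (separates⇒onCycle T-linked f-sep)) (≰⇒> heavy)

  step-preserves-separatorsLighter : ∀ {e′ T Uₖ U a T′ b} → SeparatorsLighter e′ T Uₖ → U ⊆ Uₖ →
                                     ¬ U a → MinimallyConnected T → Step G ŵ w T U a T′ b →
                                     SeparatorsLighter e′ T′ U
  step-preserves-separatorsLighter bound U⊆Uₖ _ _ (acceptInT _) = bound ∘ U⊆Uₖ
  step-preserves-separatorsLighter bound U⊆Uₖ _ _ (rejectEmpty _ _) = bound ∘ U⊆Uₖ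
  step-preserves-separatorsLighter bound U⊆Uₖ _ _ (rejectHeavy _ _ _ _ _ _) = bound ∘ U⊆Uₖ
  step-preserves-separatorsLighter {e′} {T} {a = a} bound U⊆Uₖ a∉U T-mc
    (acceptSwap _ d d∈U d-on-cycle maximal _) {f} f∈U (f∈T′ , f-cuts′) =
    -- Joinedness in T ─ f is not decided anywhere, so argue by contradiction on the
    -- decidable ŵ f < w e′ instead.
    decidable-stable (ŵ f <? w e′) λ f≮e′ →
      f≮e′ (bound (U⊆Uₖ f∈U) (proj₁ (swap-kept f∈T′ f≢a) , f≮e′ ∘ through-d))
    where
    f≢a : f ≢ a
    f≢a refl = a∉U f∈U
    d-cuts-a : Separates T d (ends a)
    d-cuts-a = onCycle⇒separates T-mc d-on-cycle λ { refl → a∉U d∈U }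

    through-d : Joined (⟦ T ⟧ ─ f) (ends e′) → ŵ f <ℚ w e′
    through-d e′-joined with swap-separates T-mc d-cuts-a f≢a (f∈T′ , f-cuts′) e′-joined
    ... | f-cuts-a , d-cuts-e′ =
      ≤-<-trans (maximal f f∈U (separates⇒onCycle (linked T-mc) f-cuts-a)) (bound (U⊆Uₖ d∈U) d-cuts-e′)

  module OnRun (R : Run G ŵ w) where
    open Run R

    arrival-seen : ∀ {k} (k<m : k < m) → ¬ Unseen G arr (suc k) (arr (fromℕ< k<m))
    arrival-seen k<m unseen = unseen (fromℕ< k<m) (s≤s (≤-reflexive (toℕ-fromℕ< k<m))) refl

    unseen-shrinks : ∀ {k} → Unseen G arr (suc k) ⊆ Unseen G arr k
    unseen-shrinks unseen j j<k = unseen j (m<n⇒m<1+n j<k)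

    step-at : ∀ {k} (k<m : k < m) →
              Step G ŵ w (tree k) (Unseen G arr (suc k)) (arr (fromℕ< k<m)) (tree (suc k)) (acc (fromℕ< k<m))
    step-at k<m =
      subst (λ t → Step G ŵ w (tree t) (Unseen G arr (suc t)) (arr j) (tree (suc t)) (acc j))
            (toℕ-fromℕ< k<m) (steps j)
      where
      j = fromℕ< k<m

    tree-minimallyConnected : ∀ {k} → k ≤ m → MinimallyConnected (tree k)
    tree-minimallyConnected {zero} _ = spanningTree⇒minimallyConnected (proj₁ initMST)
    tree-minimallyConnected {suc k} k<m =
      step-preserves-minimallyConnected (tree-minimallyConnected (<⇒≤ k<m)) (arrival-seen k<m) (step-at k<m)

    separators-lighter : ∀ i → acc i ≡ false → ∀ {k} → suc (toℕ i) ≤′ k → k ≤ m →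
                         SeparatorsLighter (arr i) (tree k) (Unseen G arr k)
    separators-lighter i rejected ≤′-refl _ =
      rejection-establishes (linked (tree-minimallyConnected (<⇒≤ (toℕ<n i)))) (steps i) rejected
    separators-lighter i rejected (≤′-step i<k) k<m =
      step-preserves-separatorsLighter (separators-lighter i rejected i<k (<⇒≤ k<m)) unseen-shrinks
        (arrival-seen k<m) (tree-minimallyConnected (<⇒≤ k<m)) (step-at k<m)

mainTheorem14 : (G : Graph) → Connected G (allEdges G) →
    (ŵ w : E G → ℚ) → Positive ŵ → Positive w →
    (R : Run G ŵ w) →
    (i : Fin (Graph.m G)) → Run.acc R i ≡ false →
    (k : ℕ) → suc (toℕ i) ≤ k → k ≤ Graph.m G →
    (e : E G) → Unseen G (Run.arr R) k e →
    OnCycle G (Run.tree R k) (Run.arr R i) e →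
    ŵ e <ℚ w (Run.arr R i)
mainTheorem14 G _ ŵ w _ _ R i rejected k i<k k≤m e unseen on-cycle =
  separators-lighter i rejected (≤⇒≤′ i<k) k≤m unseen
    (onCycle⇒separates (tree-minimallyConnected k≤m) on-cycle λ { refl → unseen i i<k refl })
  where
  open Connectivity G
  open GFtP.OnRun G ŵ w R
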